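{- Let $\Gamma=(V,E)$ be a finite $k$-regular graph with $k\ge 1$. Let $\pi=\{V_1,\ldots,V_m\}$ and $\tau=\{W_1,\ldots,W_n\}$ be (not necessarily distinct) equitable partitions of $\Gamma$ with quotient matrices $M_\pi=(b_{ij})_{1\le i,j\le m}$ and $M_\tau=(c_{ij})_{1\le i,j\le n}$. Let $1\le i,j\le n$ with $i\ne j$ be such that the induced subgraph $\Gamma[W_j]$ is not a connected component of $\Gamma$ (so that $k+c_{ij}-c_{jj}>0$), and put $r_{ij}=c_{ij}/(k+c_{ij}-c_{jj})$. Then: (a) the linear system in unknowns $x_1,\ldots,x_n$ $$\sum_{s=1}^n c_{ls}x_s+(c_{ij}-c_{jj})x_l=(c_{lj}-c_{ij})+\delta_{lj}(c_{ij}-c_{jj}),\qquad 1\le l\le n,$$ (i.e. $(M_\tau+(c_{ij}-c_{jj})I_n)x=$ the vector with $l$-th entry $(c_{lj}-c_{ij})+\delta_{lj}(c_{ij}-c_{jj})$) is consistent; (b) for any solution $(d_1,\ldots,d_n)$ of this system, the vector $[h_1,\ldots,h_m]^\top$ defined by $$h_t=-r_{ij}-\sum_{l=1}^n\frac{|V_t\cap W_l|}{|V_t|}(d_l-\delta_{lj}),\qquad 1\le t\le m,$$ satisfies $(M_\pi+(c_{ij}-c_{jj})I_m)[h_1,\ldots,h_m]^\top=0$; (c) in particular, either $(h_1,\ldots,h_m)=(0,\ldots,0)$, or $c_{jj}-c_{ij}$ is an eigenvalue of $M_\pi$ (and hence an eigenvalue of $\Gamma$) with $[h_1,\ldots,h_m]^\top$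 as a corresponding eigenvector.
   Context: Graphs are finite, undirected, without loops or multiple edges. A partition $\{V_1,\ldots,V_m\}$ of the vertex set is an equitable partition with quotient matrix $(b_{ij})$ if for all $i,j$ every vertex of $V_i$ has exactly $b_{ij}$ neighbours in $V_j$. Eigenvalues of $\Gamma$ are eigenvalues of its adjacency matrix. $\delta$ is the Kronecker delta. -}

module Defs where

open import Data.Nat using (ℕ; zero; suc; _+_; _∸_; _<_; _≤_)
open import Data.Integer using (+_)
open import Data.Rational using (ℚ; 0ℚ; 1ℚ; _/_) renaming (_+_ to _+ℚ_; _*_ to _*ℚ_; _-_ to _-ℚ_)
open import Data.Fin using (Fin; zero; suc; _≟_)
open import Data.Bool using (Bool; true; false; if_then_else_; _∧_; not)
open import Data.Product using (Σ; ∃; _×_; _,_)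
open import Relation.Nullary using (¬_)
open import Relation.Nullary.Decidable using (⌊_⌋)
open import Relation.Binary.PropositionalEquality using (_≡_)

record Graph (N : ℕ) : Set where
  field
    adj    : Fin N → Fin N → Bool
    sym    : ∀ u v → adj u v ≡ adj v u
    irrefl : ∀ u → adj u u ≡ false
open Graph public

count : ∀ {N} → (Fin N → Bool) → ℕ
count {zero}  f = 0
count {suc N} f = (if f zero then 1 else 0) + count (λ x → f (suc x))

nbrsIn : ∀ {N} → Graph N → Fin N → (Fin N → Bool) → ℕ
nbrsIn G v S = count (λ w → adj G v w ∧ S w)

degree : ∀ {N} → Graph N → Fin N → ℕ
degree G v = count (adj G v)

IsRegular : ∀ {N} → Graph N → ℕ → Set
IsRegular G k = ∀ v → degree G v ≡ k

-- Partitions {V_1,…,V_m} of Fin N, given by the map vertex ↦ index of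
-- its cell; cells of a partition are nonempty.

IsPartition : ∀ {N m} → (Fin N → Fin m) → Set
IsPartition {N} p = ∀ i → ∃ λ (v : Fin N) → p v ≡ i

cell : ∀ {N m} → (Fin N → Fin m) → Fin m → Fin N → Bool
cell p i v = ⌊ p v ≟ i ⌋

IsEquitable : ∀ {N m} → Graph N → (Fin N → Fin m) → (Fin m → Fin m → ℕ) → Set
IsEquitable G p b =
  IsPartition p × (∀ v j → nbrsIn G v (cell p j) ≡ b (p v) j)

ℕ→ℚ : ℕ → ℚ
ℕ→ℚ n = + n / 1

-- division of a rational by a natural number (only ever used with a
-- nonzero denominator; the value at 0 is an irrelevant default)
_/ℕ_ : ℚ → ℕ → ℚ
q /ℕ zero    = 0ℚ
q /ℕ (suc n) = q *ℚ (+ 1 / suc n)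

∑ : ∀ {n} → (Fin n → ℚ) → ℚ
∑ {zero}  f = 0ℚ
∑ {suc n} f = f zero +ℚ ∑ (λ s → f (suc s))

Matrix : ℕ → Set
Matrix n = Fin n → Fin n → ℚ

_·_ : ∀ {n} → Matrix n → (Fin n → ℚ) → Fin n → ℚ
(M · x) l = ∑ (λ s → M l s *ℚ x s)

δ : ∀ {n} → Fin n → Fin n → ℚ
δ l j = if ⌊ l ≟ j ⌋ then 1ℚ else 0ℚ

IsZeroVec : ∀ {n} → (Fin n → ℚ) → Set
IsZeroVec x = ∀ t → x t ≡ 0ℚ

IsEigenvector : ∀ {n} → Matrix n → ℚ → (Fin n → ℚ) → Set
IsEigenvector M λ₀ x = (¬ IsZeroVec x) × (∀ t → (M · x) t ≡ λ₀ *ℚ x t)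

IsEigenvalue : ∀ {n} → Matrix n → ℚ → Set
IsEigenvalue {n} M λ₀ = ∃ λ (x : Fin n → ℚ) → IsEigenvector M λ₀ x

toℚMat : ∀ {n} → (Fin n → Fin n → ℕ) → Matrix n
toℚMat b i j = ℕ→ℚ (b i j)

adjMatrix : ∀ {N} → Graph N → Matrix N
adjMatrix G u v = if adj G u v then 1ℚ else 0ℚ

IsSolution : ∀ {n} → (Fin n → Fin n → ℕ) → Fin n → Fin n → (Fin n → ℚ) → Set
IsSolution c i j x =
  ∀ l → ∑ (λ s → ℕ→ℚ (c l s) *ℚ x s) +ℚ ((ℕ→ℚ (c i j) -ℚ ℕ→ℚ (c j j)) *ℚ x l)
        ≡ (ℕ→ℚ (c l j) -ℚ ℕ→ℚ (c i j)) +ℚ (δ l j *ℚ (ℕ→ℚ (c i j) -ℚ ℕ→ℚ (c j j)))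

rij : ∀ {n} → ℕ → (Fin n → Fin n → ℕ) → Fin n → Fin n → ℚ
rij k c i j = ℕ→ℚ (c i j) /ℕ (k + c i j ∸ c j j)

hvec : ∀ {N m n} → Graph N → ℕ → (Fin N → Fin m) → (Fin N → Fin n)
     → (Fin n → Fin n → ℕ) → Fin n → Fin n → (Fin n → ℚ) → Fin m → ℚ
hvec G k p q c i j d t =
  (0ℚ -ℚ rij k c i j)
  -ℚ ∑ (λ l → (ℕ→ℚ (count (λ v → cell p t v ∧ cell q l v)) /ℕ count (cell p t))
              *ℚ (d l -ℚ δ l j))

-- Let d₀ = e_j − r_ij·𝟏; since every row of M_τ sums to k and r_ij (k + c_ij − c_jj) = c_ij, d₀ solves
-- the system (a). For any other solution d, w = d₀ − d lies in the kernel of M_τ + μI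
-- (μ = c_ij − c_jj), so its lift w ∘ q to the vertices satisfies A (w ∘ q) = −μ (w ∘ q).
-- Averaging over the cells of π takes such vectors to solutions of M_π h = −μ h, because A is
-- symmetric and |V_t| b_ts = |V_s| b_st; and the h of the theorem is exactly the π-average of
-- w ∘ q. The denominator k + c_ij − c_jj is positive because an edge leaves W_j, so c_jj < k.
-- A nonzero h lifts back to an eigenvector h ∘ p of A.
module Submission where

open import Defs hiding (sym)
open import Level using (0ℓ)
open import Function using (_∘_; Equivalence)
open import Data.Nat using (ℕ; zero; suc; _+_; _∸_; _≤_; _<_; z≤n; s≤s; NonZero; >-nonZero)
import Data.Nat.Properties as ℕ
import Data.Nat.Coprimality as Coprime
open import Data.Fin using (Fin; zero; suc; _≟_)
open import Data.Fin.Properties using (all?)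
open import Data.Bool using (Bool; true; false; if_then_else_; _∧_)
open import Data.Bool.Properties using (T-≡)
open import Data.Integer using (+_)
import Data.Integer as ℤ
import Data.Integer.Properties as ℤ
open import Data.Rational using (ℚ; 0ℚ; 1ℚ; mkℚ; _/_) renaming (_+_ to _+ℚ_; _-_ to _-ℚ_; _*_ to _*ℚ_; -_ to -ℚ_)
open import Data.Rational.Properties
  using ( +-*-commutativeRing; normalize-coprime; /-cong; *-inverseˡ; +-identityˡ; +-identityʳ; +-assoc
        ; *-identityˡ; *-identityʳ; *-zeroˡ; *-zeroʳ; *-assoc; *-comm; *-distribʳ-+)
  renaming (_≟_ to _≟ℚ_)
open import Data.Product using (∃; _×_; _,_; proj₁; proj₂)
open import Data.Sum using (_⊎_; inj₁; inj₂)
open import Relation.Nullary using (yes; no; contradiction)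
open import Relation.Nullary.Decidable using (⌊_⌋; toWitness; fromWitness; dec⇒maybe)
open import Relation.Binary.PropositionalEquality
  using (_≡_; _≢_; refl; sym; trans; cong; cong₂; module ≡-Reasoning)
open import Algebra.Bundles using (CommutativeRing)
import Algebra.Properties.Semiring.Sum as SemiringSum
import Tactic.RingSolver.Core.AlmostCommutativeRing as ACR
open import Tactic.RingSolver using (solve-∀)

private
  variable
    N m n : ℕ

ℚ-ring : ACR.AlmostCommutativeRing 0ℓ 0ℓ
ℚ-ring = ACR.fromCommutativeRing +-*-commutativeRing (λ x → dec⇒maybe (0ℚ ≟ℚ x))

*-distribˡ-sub : ∀ a x y → a *ℚ (x -ℚ y) ≡ a *ℚ x -ℚ a *ℚ y
*-distribˡ-sub = solve-∀ ℚ-ring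

ℕ→ℚ-suc : ∀ n → ℕ→ℚ (suc n) ≡ 1ℚ +ℚ ℕ→ℚ n
ℕ→ℚ-suc n = trans (/-cong {p₁ = + suc n} {q₁ = 1} numerator refl) (cong (1ℚ +ℚ_) (sym ℕ→ℚ≡mkℚ))
  where
  numerator : + suc n ≡ + 1 ℤ.* + 1 ℤ.+ + n ℤ.* + 1
  numerator = cong (λ x → + 1 ℤ.+ x) (sym (ℤ.*-identityʳ (+ n)))
  ℕ→ℚ≡mkℚ : ℕ→ℚ n ≡ mkℚ (+ n) 0 (Coprime.sym (Coprime.1-coprimeTo n))
  ℕ→ℚ≡mkℚ = normalize-coprime (Coprime.sym (Coprime.1-coprimeTo n))

ℕ→ℚ-homo-+ : ∀ a b → ℕ→ℚ (a + b) ≡ ℕ→ℚ a +ℚ ℕ→ℚ b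
ℕ→ℚ-homo-+ zero    b = sym (+-identityˡ (ℕ→ℚ b))
ℕ→ℚ-homo-+ (suc a) b = begin
  ℕ→ℚ (suc (a + b))         ≡⟨ ℕ→ℚ-suc (a + b) ⟩
  1ℚ +ℚ ℕ→ℚ (a + b)         ≡⟨ cong (1ℚ +ℚ_) (ℕ→ℚ-homo-+ a b) ⟩
  1ℚ +ℚ (ℕ→ℚ a +ℚ ℕ→ℚ b)    ≡⟨ sym (+-assoc 1ℚ (ℕ→ℚ a) (ℕ→ℚ b)) ⟩
  (1ℚ +ℚ ℕ→ℚ a) +ℚ ℕ→ℚ b    ≡⟨ cong (_+ℚ ℕ→ℚ b) (sym (ℕ→ℚ-suc a)) ⟩
  ℕ→ℚ (suc a) +ℚ ℕ→ℚ b      ∎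
  where open ≡-Reasoning

ℕ→ℚ-∸ : ∀ {a b} → b ≤ a → ℕ→ℚ (a ∸ b) ≡ ℕ→ℚ a -ℚ ℕ→ℚ b
ℕ→ℚ-∸ {a} {b} b≤a = begin
  ℕ→ℚ (a ∸ b)                        ≡⟨ add-sub (ℕ→ℚ (a ∸ b)) (ℕ→ℚ b) ⟩
  (ℕ→ℚ (a ∸ b) +ℚ ℕ→ℚ b) -ℚ ℕ→ℚ b    ≡⟨ cong (_-ℚ ℕ→ℚ b) (sym (ℕ→ℚ-homo-+ (a ∸ b) b)) ⟩
  ℕ→ℚ (a ∸ b + b) -ℚ ℕ→ℚ b           ≡⟨ cong (λ x → ℕ→ℚ x -ℚ ℕ→ℚ b) (ℕ.m∸n+n≡m b≤a) ⟩
  ℕ→ℚ a -ℚ ℕ→ℚ b                     ∎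
  where
  open ≡-Reasoning
  add-sub : ∀ x y → x ≡ (x +ℚ y) -ℚ y
  add-sub = solve-∀ ℚ-ring

-- the factors normalise to mkℚ 1 n and mkℚ (1 + n) 0
1/suc-inverseˡ : ∀ n → (+ 1 / suc n) *ℚ ℕ→ℚ (suc n) ≡ 1ℚ
1/suc-inverseˡ n rewrite normalize-coprime (Coprime.sym (Coprime.1-coprimeTo (suc n)))
                       | normalize-coprime {1} {n} (Coprime.1-coprimeTo (suc n))
  = *-inverseˡ (mkℚ (+ suc n) 0 (Coprime.sym (Coprime.1-coprimeTo (suc n))))

/ℕ-*-cancel : ∀ x n .{{_ : NonZero n}} → (x /ℕ n) *ℚ ℕ→ℚ n ≡ x
/ℕ-*-cancel x (suc n) = begin
  (x *ℚ (+ 1 / suc n)) *ℚ ℕ→ℚ (suc n)  ≡⟨ *-assoc x _ _ ⟩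
  x *ℚ ((+ 1 / suc n) *ℚ ℕ→ℚ (suc n))  ≡⟨ cong (x *ℚ_) (1/suc-inverseˡ n) ⟩
  x *ℚ 1ℚ                              ≡⟨ *-identityʳ x ⟩
  x                                    ∎
  where open ≡-Reasoning

/ℕ-*-comm : ∀ x y n → (x /ℕ n) *ℚ y ≡ (x *ℚ y) /ℕ n
/ℕ-*-comm x y zero    = *-zeroˡ y
/ℕ-*-comm x y (suc n) = reorder x y (+ 1 / suc n)
  where
  reorder : ∀ x y ρ → (x *ℚ ρ) *ℚ y ≡ (x *ℚ y) *ℚ ρ
  reorder = solve-∀ ℚ-ring

*-/ℕ-assoc : ∀ x y n → x *ℚ (y /ℕ n) ≡ (x *ℚ y) /ℕ n
*-/ℕ-assoc x y zero    = *-zeroʳ x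
*-/ℕ-assoc x y (suc n) = sym (*-assoc x y (+ 1 / suc n))

+-/ℕ-cancel : ∀ x y n .{{_ : NonZero n}} → (x +ℚ y *ℚ ℕ→ℚ n) /ℕ n ≡ x /ℕ n +ℚ y
+-/ℕ-cancel x y (suc n) = begin
  (x +ℚ y *ℚ n′) *ℚ ρ        ≡⟨ expand x y n′ ρ ⟩
  x *ℚ ρ +ℚ y *ℚ (ρ *ℚ n′)   ≡⟨ cong (λ z → x *ℚ ρ +ℚ y *ℚ z) (1/suc-inverseˡ n) ⟩
  x *ℚ ρ +ℚ y *ℚ 1ℚ          ≡⟨ cong (x *ℚ ρ +ℚ_) (*-identityʳ y) ⟩
  x *ℚ ρ +ℚ y                ∎
  where
  open ≡-Reasoning
  ρ = + 1 / suc n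
  n′ = ℕ→ℚ (suc n)
  expand : ∀ x y a b → (x +ℚ y *ℚ a) *ℚ b ≡ x *ℚ b +ℚ y *ℚ (b *ℚ a)
  expand = solve-∀ ℚ-ring

/ℕ-balance : ∀ a b m n .{{_ : NonZero m}} .{{_ : NonZero n}} x →
             a *ℚ ℕ→ℚ m ≡ b *ℚ ℕ→ℚ n → a *ℚ (x /ℕ n) ≡ (x *ℚ b) /ℕ m
/ℕ-balance a b (suc m) (suc n) x am≡bn = begin
  a *ℚ (x *ℚ ρn)                           ≡⟨ sym (*-identityʳ _) ⟩
  (a *ℚ (x *ℚ ρn)) *ℚ 1ℚ                   ≡⟨ cong ((a *ℚ (x *ℚ ρn)) *ℚ_) (sym (1/suc-inverseˡ m)) ⟩
  (a *ℚ (x *ℚ ρn)) *ℚ (ρm *ℚ m′)           ≡⟨ regroup₁ a x ρn ρm m′ ⟩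
  (a *ℚ m′) *ℚ ((x *ℚ ρn) *ℚ ρm)           ≡⟨ cong (_*ℚ ((x *ℚ ρn) *ℚ ρm)) am≡bn ⟩
  (b *ℚ n′) *ℚ ((x *ℚ ρn) *ℚ ρm)           ≡⟨ regroup₂ b x ρn ρm n′ ⟩
  ((x *ℚ b) *ℚ ρm) *ℚ (ρn *ℚ n′)           ≡⟨ cong (((x *ℚ b) *ℚ ρm) *ℚ_) (1/suc-inverseˡ n) ⟩
  ((x *ℚ b) *ℚ ρm) *ℚ 1ℚ                   ≡⟨ *-identityʳ _ ⟩
  (x *ℚ b) *ℚ ρm                           ∎
  where
  open ≡-Reasoning
  ρm = + 1 / suc m
  ρn = + 1 / suc n
  m′ = ℕ→ℚ (suc m)
  n′ = ℕ→ℚ (suc n)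
  regroup₁ : ∀ a x ρn ρm M → (a *ℚ (x *ℚ ρn)) *ℚ (ρm *ℚ M) ≡ (a *ℚ M) *ℚ ((x *ℚ ρn) *ℚ ρm)
  regroup₁ = solve-∀ ℚ-ring
  regroup₂ : ∀ b x ρn ρm N → (b *ℚ N) *ℚ ((x *ℚ ρn) *ℚ ρm) ≡ ((x *ℚ b) *ℚ ρm) *ℚ (ρn *ℚ N)
  regroup₂ = solve-∀ ℚ-ring

private
  module ℚ-Sum = SemiringSum (CommutativeRing.semiring +-*-commutativeRing)

open ℚ-Sum using (sum)

∑≡sum : (f : Fin n → ℚ) → ∑ f ≡ sum f
∑≡sum {zero}  f = refl
∑≡sum {suc n} f = cong (f zero +ℚ_) (∑≡sum (f ∘ suc))

∑-cong : {f g : Fin n → ℚ} → (∀ s → f s ≡ g s) → ∑ f ≡ ∑ g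
∑-cong {f = f} {g} f≗g = trans (∑≡sum f) (trans (ℚ-Sum.sum-cong-≗ f≗g) (sym (∑≡sum g)))

∑-distrib-+ : (f g : Fin n → ℚ) → ∑ (λ s → f s +ℚ g s) ≡ ∑ f +ℚ ∑ g
∑-distrib-+ f g = trans (∑≡sum (λ s → f s +ℚ g s))
  (trans (ℚ-Sum.∑-distrib-+ f g) (sym (cong₂ _+ℚ_ (∑≡sum f) (∑≡sum g))))

∑-distrib-sub : (f g : Fin n → ℚ) → ∑ (λ s → f s -ℚ g s) ≡ ∑ f -ℚ ∑ g
∑-distrib-sub {zero}  f g = refl
∑-distrib-sub {suc n} f g =
  trans (cong ((f zero -ℚ g zero) +ℚ_) (∑-distrib-sub (f ∘ suc) (g ∘ suc)))
        (interchange (f zero) (g zero) (∑ (f ∘ suc)) (∑ (g ∘ suc)))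
  where
  interchange : ∀ a b c d → (a -ℚ b) +ℚ (c -ℚ d) ≡ (a +ℚ c) -ℚ (b +ℚ d)
  interchange = solve-∀ ℚ-ring

*-distribˡ-∑ : ∀ x (f : Fin n → ℚ) → x *ℚ ∑ f ≡ ∑ (λ s → x *ℚ f s)
*-distribˡ-∑ x f = trans (cong (x *ℚ_) (∑≡sum f))
  (trans (ℚ-Sum.*-distribˡ-sum x f) (sym (∑≡sum (λ s → x *ℚ f s))))

*-distribʳ-∑ : ∀ x (f : Fin n → ℚ) → ∑ f *ℚ x ≡ ∑ (λ s → f s *ℚ x)
*-distribʳ-∑ x f = trans (cong (_*ℚ x) (∑≡sum f))
  (trans (ℚ-Sum.*-distribʳ-sum x f) (sym (∑≡sum (λ s → f s *ℚ x))))

∑-comm : (f : Fin m → Fin n → ℚ) → ∑ (λ s → ∑ (f s)) ≡ ∑ (λ t → ∑ (λ s → f s t))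
∑-comm f = trans (∑∑≡sum f) (trans (ℚ-Sum.∑-comm f) (sym (∑∑≡sum (λ t s → f s t))))
  where
  ∑∑≡sum : ∀ {m n} (g : Fin m → Fin n → ℚ) → ∑ (λ s → ∑ (g s)) ≡ sum (λ s → sum (g s))
  ∑∑≡sum g = trans (∑-cong (λ s → ∑≡sum (g s))) (∑≡sum (λ s → sum (g s)))

∑-/ℕ : ∀ (f : Fin m → ℚ) n .{{_ : NonZero n}} → ∑ (λ s → f s /ℕ n) ≡ ∑ f /ℕ n
∑-/ℕ f (suc n) = sym (*-distribʳ-∑ (+ 1 / suc n) f)

𝟙 : Bool → ℚ
𝟙 b = if b then 1ℚ else 0ℚ

𝟙-∧ : ∀ a b → 𝟙 (a ∧ b) ≡ 𝟙 a *ℚ 𝟙 b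
𝟙-∧ true  b = sym (*-identityˡ (𝟙 b))
𝟙-∧ false b = sym (*-zeroˡ (𝟙 b))

δ-suc : (l s : Fin n) → 𝟙 ⌊ suc l ≟ suc s ⌋ ≡ 𝟙 ⌊ l ≟ s ⌋
δ-suc l s with l ≟ s
... | yes _ = refl
... | no  _ = refl

δ-sym : (l s : Fin n) → 𝟙 ⌊ l ≟ s ⌋ ≡ 𝟙 ⌊ s ≟ l ⌋
δ-sym l s with l ≟ s | s ≟ l
... | yes _   | yes _   = refl
... | no  _   | no  _   = refl
... | yes l≡s | no  s≢l = contradiction (sym l≡s) s≢l
... | no  l≢s | yes s≡l = contradiction (sym s≡l) l≢s

∑-δ : ∀ (l : Fin n) (f : Fin n → ℚ) → ∑ (λ s → δ l s *ℚ f s) ≡ f l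
∑-δ {suc n} zero f = trans (cong₂ _+ℚ_ (*-identityˡ (f zero)) rest≡0) (+-identityʳ (f zero))
  where
  rest≡0 : ∑ (λ s → 0ℚ *ℚ f (suc s)) ≡ 0ℚ
  rest≡0 = trans (sym (*-distribˡ-∑ 0ℚ (f ∘ suc))) (*-zeroˡ (∑ (f ∘ suc)))
∑-δ {suc n} (suc l) f = trans (cong₂ _+ℚ_ (*-zeroˡ (f zero)) rest≡fl) (+-identityˡ (f (suc l)))
  where
  rest≡fl : ∑ (λ s → δ (suc l) (suc s) *ℚ f (suc s)) ≡ f (suc l)
  rest≡fl = trans (∑-cong (λ s → cong (_*ℚ f (suc s)) (δ-suc l s))) (∑-δ l (f ∘ suc))

∑-δʳ : ∀ (l : Fin n) (f : Fin n → ℚ) → ∑ (λ s → f s *ℚ δ s l) ≡ f l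
∑-δʳ l f = trans (∑-cong (λ s → trans (*-comm (f s) _) (cong (_*ℚ f s) (δ-sym s l)))) (∑-δ l f)

count≡∑𝟙 : (f : Fin N → Bool) → ℕ→ℚ (count f) ≡ ∑ (𝟙 ∘ f)
count≡∑𝟙 {zero}  f = refl
count≡∑𝟙 {suc N} f = trans (ℕ→ℚ-homo-+ (if f zero then 1 else 0) (count (f ∘ suc)))
                           (cong₂ _+ℚ_ (ℕ→ℚ-indicator (f zero)) (count≡∑𝟙 (f ∘ suc)))
  where
  ℕ→ℚ-indicator : ∀ b → ℕ→ℚ (if b then 1 else 0) ≡ 𝟙 b
  ℕ→ℚ-indicator true  = refl
  ℕ→ℚ-indicator false = refl

count-∧ : (f g : Fin N → Bool) → ℕ→ℚ (count (λ x → f x ∧ g x)) ≡ ∑ (λ x → 𝟙 (f x) *ℚ 𝟙 (g x))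
count-∧ f g = trans (count≡∑𝟙 (λ x → f x ∧ g x)) (∑-cong (λ x → 𝟙-∧ (f x) (g x)))

count-pos : ∀ (f : Fin N → Bool) w → f w ≡ true → 0 < count f
count-pos f zero    fw rewrite fw = s≤s z≤n
count-pos f (suc w) fw with f zero
... | true  = s≤s z≤n
... | false = count-pos (f ∘ suc) w fw

count-∧-≤ : (f g : Fin N → Bool) → count (λ x → f x ∧ g x) ≤ count f
count-∧-≤ {zero}  f g = z≤n
count-∧-≤ {suc N} f g with f zero | g zero
... | true  | true  = s≤s (count-∧-≤ (f ∘ suc) (g ∘ suc))
... | true  | false = ℕ.m≤n⇒m≤1+n (count-∧-≤ (f ∘ suc) (g ∘ suc))
... | false | _     = count-∧-≤ (f ∘ suc) (g ∘ suc)

count-∧-< : ∀ (f g : Fin N → Bool) w → f w ≡ true → g w ≡ false →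
            count (λ x → f x ∧ g x) < count f
count-∧-< f g zero    fw gw rewrite fw | gw = s≤s (count-∧-≤ (f ∘ suc) (g ∘ suc))
count-∧-< f g (suc w) fw gw with f zero | g zero
... | true  | true  = s≤s (count-∧-< (f ∘ suc) (g ∘ suc) w fw gw)
... | true  | false = ℕ.m<n⇒m<1+n (count-∧-< (f ∘ suc) (g ∘ suc) w fw gw)
... | false | _     = count-∧-< (f ∘ suc) (g ∘ suc) w fw gw

cell-member : ∀ (p : Fin N → Fin m) t u → cell p t u ≡ true → p u ≡ t
cell-member p t u u∈t = toWitness (Equivalence.from T-≡ u∈t)

-- For the characteristic matrix P of p: cellSum = Pᵀ and average = D⁻¹Pᵀ, D = diag (cellSize).
module _ {N m : ℕ} (p : Fin N → Fin m) where

  cellSize : Fin m → ℕ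
  cellSize t = count (cell p t)

  cellSum : (Fin N → ℚ) → Fin m → ℚ
  cellSum g t = ∑ (λ u → g u *ℚ 𝟙 (cell p t u))

  average : (Fin N → ℚ) → Fin m → ℚ
  average g t = cellSum g t /ℕ cellSize t

  cellSize-nonZero : IsPartition p → ∀ t → NonZero (cellSize t)
  cellSize-nonZero part t with part t
  ... | v , pv≡t = >-nonZero (count-pos (cell p t) v (Equivalence.to T-≡ (fromWitness pv≡t)))

  ∑-fibres : ∀ (g : Fin N → ℚ) (f : Fin m → ℚ) →
             ∑ (λ u → g u *ℚ f (p u)) ≡ ∑ (λ s → cellSum g s *ℚ f s)
  ∑-fibres g f = begin
    ∑ (λ u → g u *ℚ f (p u))
      ≡⟨ ∑-cong (λ u → cong (g u *ℚ_) (sym (∑-δ (p u) f))) ⟩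
    ∑ (λ u → g u *ℚ ∑ (λ s → δ (p u) s *ℚ f s))
      ≡⟨ ∑-cong (λ u → *-distribˡ-∑ (g u) (λ s → δ (p u) s *ℚ f s)) ⟩
    ∑ (λ u → ∑ (λ s → g u *ℚ (δ (p u) s *ℚ f s)))
      ≡⟨ ∑-comm (λ u s → g u *ℚ (δ (p u) s *ℚ f s)) ⟩
    ∑ (λ s → ∑ (λ u → g u *ℚ (δ (p u) s *ℚ f s)))
      ≡⟨ ∑-cong (λ s → ∑-cong (λ u → sym (*-assoc (g u) _ (f s)))) ⟩
    ∑ (λ s → ∑ (λ u → (g u *ℚ δ (p u) s) *ℚ f s))
      ≡⟨ ∑-cong (λ s → sym (*-distribʳ-∑ (f s) (λ u → g u *ℚ δ (p u) s))) ⟩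
    ∑ (λ s → cellSum g s *ℚ f s)
      ∎
    where open ≡-Reasoning

  cellSum-lift : ∀ (f : Fin m → ℚ) t → cellSum (f ∘ p) t ≡ f t *ℚ ℕ→ℚ (cellSize t)
  cellSum-lift f t = begin
    ∑ (λ u → f (p u) *ℚ δ (p u) t)    ≡⟨ ∑-cong restrict ⟩
    ∑ (λ u → f t *ℚ δ (p u) t)        ≡⟨ sym (*-distribˡ-∑ (f t) (λ u → δ (p u) t)) ⟩
    f t *ℚ ∑ (λ u → 𝟙 (cell p t u))   ≡⟨ cong (f t *ℚ_) (sym (count≡∑𝟙 (cell p t))) ⟩
    f t *ℚ ℕ→ℚ (cellSize t)           ∎
    where
    open ≡-Reasoning
    restrict : ∀ u → f (p u) *ℚ 𝟙 ⌊ p u ≟ t ⌋ ≡ f t *ℚ 𝟙 ⌊ p u ≟ t ⌋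
    restrict u with p u ≟ t
    ... | yes pu≡t = cong (λ s → f s *ℚ 1ℚ) pu≡t
    ... | no  _    = trans (*-zeroʳ (f (p u))) (sym (*-zeroʳ (f t)))

  average-cong : ∀ {g g′ : Fin N → ℚ} → (∀ u → g u ≡ g′ u) → ∀ t → average g t ≡ average g′ t
  average-cong g≗g′ t =
    cong (_/ℕ cellSize t) (∑-cong (λ u → cong (_*ℚ 𝟙 (cell p t u)) (g≗g′ u)))

  average-* : ∀ a (g : Fin N → ℚ) t → average (λ u → a *ℚ g u) t ≡ a *ℚ average g t
  average-* a g t = begin
    cellSum (λ u → a *ℚ g u) t /ℕ cellSize t
      ≡⟨ cong (_/ℕ cellSize t) (∑-cong (λ u → *-assoc a (g u) _)) ⟩
    ∑ (λ u → a *ℚ (g u *ℚ 𝟙 (cell p t u))) /ℕ cellSize t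
      ≡⟨ cong (_/ℕ cellSize t) (sym (*-distribˡ-∑ a (λ u → g u *ℚ 𝟙 (cell p t u)))) ⟩
    (a *ℚ cellSum g t) /ℕ cellSize t
      ≡⟨ sym (*-/ℕ-assoc a (cellSum g t) (cellSize t)) ⟩
    a *ℚ average g t
      ∎
    where open ≡-Reasoning

  average-+-const : ∀ (g : Fin N → ℚ) x t .{{_ : NonZero (cellSize t)}} →
                    average (λ u → g u +ℚ x) t ≡ average g t +ℚ x
  average-+-const g x t = begin
    cellSum (λ u → g u +ℚ x) t /ℕ cellSize t              ≡⟨ cong (_/ℕ cellSize t) split ⟩
    (cellSum g t +ℚ x *ℚ ℕ→ℚ (cellSize t)) /ℕ cellSize t  ≡⟨ +-/ℕ-cancel (cellSum g t) x (cellSize t) ⟩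
    average g t +ℚ x                                      ∎
    where
    open ≡-Reasoning
    split : cellSum (λ u → g u +ℚ x) t ≡ cellSum g t +ℚ x *ℚ ℕ→ℚ (cellSize t)
    split = begin
      ∑ (λ u → (g u +ℚ x) *ℚ 𝟙 (cell p t u))
        ≡⟨ ∑-cong (λ u → *-distribʳ-+ (𝟙 (cell p t u)) (g u) x) ⟩
      ∑ (λ u → g u *ℚ 𝟙 (cell p t u) +ℚ x *ℚ 𝟙 (cell p t u))
        ≡⟨ ∑-distrib-+ (λ u → g u *ℚ 𝟙 (cell p t u)) (λ u → x *ℚ 𝟙 (cell p t u)) ⟩
      cellSum g t +ℚ cellSum (λ _ → x) t
        ≡⟨ cong (cellSum g t +ℚ_) (cellSum-lift (λ _ → x) t) ⟩
      cellSum g t +ℚ x *ℚ ℕ→ℚ (cellSize t)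
        ∎

average-lift : ∀ (p : Fin N → Fin m) (q : Fin N → Fin n) (z : Fin n → ℚ) t .{{_ : NonZero (cellSize p t)}} →
               ∑ (λ l → (ℕ→ℚ (count (λ v → cell p t v ∧ cell q l v)) /ℕ cellSize p t) *ℚ z l)
               ≡ average p (z ∘ q) t
average-lift p q z t = begin
  ∑ (λ l → (meet l /ℕ cellSize p t) *ℚ z l)  ≡⟨ ∑-cong (λ l → /ℕ-*-comm (meet l) (z l) (cellSize p t)) ⟩
  ∑ (λ l → (meet l *ℚ z l) /ℕ cellSize p t)  ≡⟨ ∑-/ℕ (λ l → meet l *ℚ z l) (cellSize p t) ⟩
  ∑ (λ l → meet l *ℚ z l) /ℕ cellSize p t    ≡⟨ cong (_/ℕ cellSize p t) regroup ⟩
  average p (z ∘ q) t                        ∎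
  where
  open ≡-Reasoning
  meet : Fin _ → ℚ
  meet l = ℕ→ℚ (count (λ v → cell p t v ∧ cell q l v))
  regroup : ∑ (λ l → meet l *ℚ z l) ≡ cellSum p (z ∘ q) t
  regroup = begin
    ∑ (λ l → meet l *ℚ z l)
      ≡⟨ ∑-cong (λ l → cong (_*ℚ z l) (count-∧ (cell p t) (cell q l))) ⟩
    ∑ (λ l → cellSum q (λ u → 𝟙 (cell p t u)) l *ℚ z l)
      ≡⟨ sym (∑-fibres q (λ u → 𝟙 (cell p t u)) z) ⟩
    ∑ (λ u → 𝟙 (cell p t u) *ℚ z (q u))
      ≡⟨ ∑-cong (λ u → *-comm _ (z (q u))) ⟩
    cellSum p (z ∘ q) t
      ∎

module _ {N m : ℕ} (G : Graph N) (p : Fin N → Fin m) (b : Fin m → Fin m → ℕ) (eqp : IsEquitable G p b) where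

  private
    A : Matrix N
    A = adjMatrix G

  ·cell≡quotient : ∀ v s → (A · (λ u → 𝟙 (cell p s u))) v ≡ ℕ→ℚ (b (p v) s)
  ·cell≡quotient v s = trans (sym (count-∧ (adj G v) (cell p s))) (cong ℕ→ℚ (proj₂ eqp v s))

  ·-lift : ∀ (f : Fin m → ℚ) v → (A · (f ∘ p)) v ≡ (toℚMat b · f) (p v)
  ·-lift f v = trans (∑-fibres p (A v) f) (∑-cong (λ s → cong (_*ℚ f s) (·cell≡quotient v s)))

  -- PᵀA = (AP)ᵀ = (PB)ᵀ, by symmetry of A
  cellSum-adj : ∀ (g : Fin N → ℚ) t → cellSum p (A · g) t ≡ ∑ (λ u → g u *ℚ ℕ→ℚ (b (p u) t))
  cellSum-adj g t = begin
    ∑ (λ v → (A · g) v *ℚ 𝟙 (cell p t v))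
      ≡⟨ ∑-cong (λ v → *-distribʳ-∑ _ (λ u → A v u *ℚ g u)) ⟩
    ∑ (λ v → ∑ (λ u → (A v u *ℚ g u) *ℚ 𝟙 (cell p t v)))
      ≡⟨ ∑-comm (λ v u → (A v u *ℚ g u) *ℚ 𝟙 (cell p t v)) ⟩
    ∑ (λ u → ∑ (λ v → (A v u *ℚ g u) *ℚ 𝟙 (cell p t v)))
      ≡⟨ ∑-cong (λ u → ∑-cong (λ v → transpose u v)) ⟩
    ∑ (λ u → ∑ (λ v → g u *ℚ (A u v *ℚ 𝟙 (cell p t v))))
      ≡⟨ ∑-cong (λ u → sym (*-distribˡ-∑ (g u) (λ v → A u v *ℚ 𝟙 (cell p t v)))) ⟩
    ∑ (λ u → g u *ℚ (A · (λ v → 𝟙 (cell p t v))) u)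
      ≡⟨ ∑-cong (λ u → cong (g u *ℚ_) (·cell≡quotient u t)) ⟩
    ∑ (λ u → g u *ℚ ℕ→ℚ (b (p u) t))
      ∎
    where
    open ≡-Reasoning
    reassoc : ∀ a y e → (a *ℚ y) *ℚ e ≡ y *ℚ (a *ℚ e)
    reassoc = solve-∀ ℚ-ring
    transpose : ∀ u v → (A v u *ℚ g u) *ℚ 𝟙 (cell p t v) ≡ g u *ℚ (A u v *ℚ 𝟙 (cell p t v))
    transpose u v = trans (cong (λ a → (𝟙 a *ℚ g u) *ℚ 𝟙 (cell p t v)) (Graph.sym G v u))
                          (reassoc (A u v) (g u) (𝟙 (cell p t v)))

  -- both sides count the edges between the cells V_s and V_t
  cellSize-quotient-sym : ∀ s t →
                          ℕ→ℚ (b t s) *ℚ ℕ→ℚ (cellSize p t) ≡ ℕ→ℚ (b s t) *ℚ ℕ→ℚ (cellSize p s)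
  cellSize-quotient-sym s t = begin
    ℕ→ℚ (b t s) *ℚ ℕ→ℚ (cellSize p t)
      ≡⟨ sym (cellSum-lift p (λ r → ℕ→ℚ (b r s)) t) ⟩
    cellSum p (λ u → ℕ→ℚ (b (p u) s)) t
      ≡⟨ ∑-cong (λ v → cong (_*ℚ 𝟙 (cell p t v)) (sym (·cell≡quotient v s))) ⟩
    cellSum p (A · (λ u → 𝟙 (cell p s u))) t
      ≡⟨ cellSum-adj (λ u → 𝟙 (cell p s u)) t ⟩
    ∑ (λ u → 𝟙 (cell p s u) *ℚ ℕ→ℚ (b (p u) t))
      ≡⟨ ∑-cong (λ u → *-comm (𝟙 (cell p s u)) _) ⟩
    cellSum p (λ u → ℕ→ℚ (b (p u) t)) s
      ≡⟨ cellSum-lift p (λ r → ℕ→ℚ (b r t)) s ⟩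
    ℕ→ℚ (b s t) *ℚ ℕ→ℚ (cellSize p s)
      ∎
    where open ≡-Reasoning

  average-eigen : ∀ {λ₀} {g : Fin N → ℚ} → (∀ v → (A · g) v ≡ λ₀ *ℚ g v) →
                  ∀ t → (toℚMat b · average p g) t ≡ λ₀ *ℚ average p g t
  average-eigen {λ₀} {g} Ag≡λg t = begin
    ∑ (λ s → ℕ→ℚ (b t s) *ℚ average p g s)
      ≡⟨ ∑-cong balance ⟩
    ∑ (λ s → (cellSum p g s *ℚ ℕ→ℚ (b s t)) /ℕ cellSize p t)
      ≡⟨ ∑-/ℕ (λ s → cellSum p g s *ℚ ℕ→ℚ (b s t)) (cellSize p t) ⟩
    ∑ (λ s → cellSum p g s *ℚ ℕ→ℚ (b s t)) /ℕ cellSize p t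
      ≡⟨ cong (_/ℕ cellSize p t) (sym (∑-fibres p g (λ s → ℕ→ℚ (b s t)))) ⟩
    ∑ (λ u → g u *ℚ ℕ→ℚ (b (p u) t)) /ℕ cellSize p t
      ≡⟨ cong (_/ℕ cellSize p t) (sym (cellSum-adj g t)) ⟩
    average p (A · g) t
      ≡⟨ average-cong p Ag≡λg t ⟩
    average p (λ v → λ₀ *ℚ g v) t
      ≡⟨ average-* p λ₀ g t ⟩
    λ₀ *ℚ average p g t
      ∎
    where
    open ≡-Reasoning
    instance
      cellSize-t≢0 : NonZero (cellSize p t)
      cellSize-t≢0 = cellSize-nonZero p (proj₁ eqp) t
    balance : ∀ s → ℕ→ℚ (b t s) *ℚ average p g s ≡ (cellSum p g s *ℚ ℕ→ℚ (b s t)) /ℕ cellSize p t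
    balance s = /ℕ-balance (ℕ→ℚ (b t s)) (ℕ→ℚ (b s t)) (cellSize p t) (cellSize p s)
                           (cellSum p g s) (cellSize-quotient-sym s t)
      where
      instance
        cellSize-s≢0 : NonZero (cellSize p s)
        cellSize-s≢0 = cellSize-nonZero p (proj₁ eqp) s

  lift-zero⇒zero : ∀ {h : Fin m → ℚ} → IsZeroVec (h ∘ p) → IsZeroVec h
  lift-zero⇒zero hp≡0 t with proj₁ eqp t
  ... | v , refl = hp≡0 v

  eigenvector-lift : ∀ {λ₀ h} → IsEigenvector (toℚMat b) λ₀ h → IsEigenvector A λ₀ (h ∘ p)
  eigenvector-lift {λ₀} {h} (h≢0 , Bh≡λh) =
    h≢0 ∘ lift-zero⇒zero , λ v → trans (·-lift h v) (Bh≡λh (p v))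

  zero-or-eigen : ∀ {λ₀ h} → (∀ t → (toℚMat b · h) t ≡ λ₀ *ℚ h t) →
                  IsZeroVec h ⊎ (IsEigenvector (toℚMat b) λ₀ h × IsEigenvalue A λ₀)
  zero-or-eigen {λ₀} {h} Bh≡λh with all? (λ t → h t ≟ℚ 0ℚ)
  ... | yes h≡0 = inj₁ h≡0
  ... | no  h≢0 = inj₂ (eigenvector , h ∘ p , eigenvector-lift {λ₀} {h} eigenvector)
    where
    eigenvector : IsEigenvector (toℚMat b) λ₀ h
    eigenvector = h≢0 , Bh≡λh

difference-of-solutions-eigen : ∀ (M : Matrix n) α β (e : Fin n → ℚ) {x x′ : Fin n → ℚ} →
  (∀ l → (M · x) l +ℚ (α -ℚ β) *ℚ x l ≡ e l) → (∀ l → (M · x′) l +ℚ (α -ℚ β) *ℚ x′ l ≡ e l) →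
  ∀ l → (M · (λ s → x s -ℚ x′ s)) l ≡ (β -ℚ α) *ℚ (x l -ℚ x′ l)
difference-of-solutions-eigen M α β e {x} {x′} x-solves x′-solves l = begin
  ∑ (λ s → M l s *ℚ (x s -ℚ x′ s))
    ≡⟨ ∑-cong (λ s → *-distribˡ-sub (M l s) (x s) (x′ s)) ⟩
  ∑ (λ s → M l s *ℚ x s -ℚ M l s *ℚ x′ s)
    ≡⟨ ∑-distrib-sub (λ s → M l s *ℚ x s) (λ s → M l s *ℚ x′ s) ⟩
  Mx -ℚ Mx′
    ≡⟨ regroup Mx Mx′ (x l) (x′ l) α β ⟩
  ((Mx +ℚ (α -ℚ β) *ℚ x l) -ℚ (Mx′ +ℚ (α -ℚ β) *ℚ x′ l)) +ℚ (β -ℚ α) *ℚ (x l -ℚ x′ l)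
    ≡⟨ cong₂ (λ y y′ → (y -ℚ y′) +ℚ (β -ℚ α) *ℚ (x l -ℚ x′ l)) (x-solves l) (x′-solves l) ⟩
  (e l -ℚ e l) +ℚ (β -ℚ α) *ℚ (x l -ℚ x′ l)
    ≡⟨ cancel (e l) ((β -ℚ α) *ℚ (x l -ℚ x′ l)) ⟩
  (β -ℚ α) *ℚ (x l -ℚ x′ l)
    ∎
  where
  open ≡-Reasoning
  Mx = (M · x) l
  Mx′ = (M · x′) l
  regroup : ∀ P P′ y y′ α β →
            P -ℚ P′ ≡ ((P +ℚ (α -ℚ β) *ℚ y) -ℚ (P′ +ℚ (α -ℚ β) *ℚ y′)) +ℚ (β -ℚ α) *ℚ (y -ℚ y′)
  regroup = solve-∀ ℚ-ring
  cancel : ∀ y z → (y -ℚ y) +ℚ z ≡ z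
  cancel = solve-∀ ℚ-ring

eigen⇒shifted-kernel : ∀ α β z {X} → X ≡ (β -ℚ α) *ℚ z → X +ℚ (α -ℚ β) *ℚ z ≡ 0ℚ
eigen⇒shifted-kernel α β z refl = opposite α β z
  where
  opposite : ∀ α β z → (β -ℚ α) *ℚ z +ℚ (α -ℚ β) *ℚ z ≡ 0ℚ
  opposite = solve-∀ ℚ-ring

δ-minus-const-solves : ∀ (c : Fin n → Fin n → ℕ) i j {K r} →
  (∀ l → ∑ (λ s → ℕ→ℚ (c l s)) ≡ K) →
  r *ℚ (K +ℚ (ℕ→ℚ (c i j) -ℚ ℕ→ℚ (c j j))) ≡ ℕ→ℚ (c i j) →
  IsSolution c i j (λ l → δ l j -ℚ r)
δ-minus-const-solves c i j {K} {r} rowSum≡K r[K+μ]≡cij l = begin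
  ∑ (λ s → C l s *ℚ (δ s j -ℚ r)) +ℚ μ *ℚ (δ l j -ℚ r)
    ≡⟨ cong (_+ℚ μ *ℚ (δ l j -ℚ r)) row·d₀ ⟩
  (C l j -ℚ K *ℚ r) +ℚ μ *ℚ (δ l j -ℚ r)
    ≡⟨ regroup (C l j) K r cij cjj (δ l j) ⟩
  ((C l j -ℚ cij) +ℚ δ l j *ℚ μ) +ℚ (cij -ℚ r *ℚ (K +ℚ μ))
    ≡⟨ cong (λ y → ((C l j -ℚ cij) +ℚ δ l j *ℚ μ) +ℚ (cij -ℚ y)) r[K+μ]≡cij ⟩
  ((C l j -ℚ cij) +ℚ δ l j *ℚ μ) +ℚ (cij -ℚ cij)
    ≡⟨ cancel ((C l j -ℚ cij) +ℚ δ l j *ℚ μ) cij ⟩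
  (C l j -ℚ cij) +ℚ δ l j *ℚ μ
    ∎
  where
  open ≡-Reasoning
  C = toℚMat c
  cij = ℕ→ℚ (c i j)
  cjj = ℕ→ℚ (c j j)
  μ = cij -ℚ cjj
  row·d₀ : ∑ (λ s → C l s *ℚ (δ s j -ℚ r)) ≡ C l j -ℚ K *ℚ r
  row·d₀ = begin
    ∑ (λ s → C l s *ℚ (δ s j -ℚ r))
      ≡⟨ ∑-cong (λ s → *-distribˡ-sub (C l s) (δ s j) r) ⟩
    ∑ (λ s → C l s *ℚ δ s j -ℚ C l s *ℚ r)
      ≡⟨ ∑-distrib-sub (λ s → C l s *ℚ δ s j) (λ s → C l s *ℚ r) ⟩
    ∑ (λ s → C l s *ℚ δ s j) -ℚ ∑ (λ s → C l s *ℚ r)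
      ≡⟨ cong₂ _-ℚ_ (∑-δʳ j (C l)) (trans (sym (*-distribʳ-∑ r (C l))) (cong (_*ℚ r) (rowSum≡K l))) ⟩
    C l j -ℚ K *ℚ r
      ∎
  regroup : ∀ x K r a b δ → (x -ℚ K *ℚ r) +ℚ (a -ℚ b) *ℚ (δ -ℚ r)
                          ≡ ((x -ℚ a) +ℚ δ *ℚ (a -ℚ b)) +ℚ (a -ℚ r *ℚ (K +ℚ (a -ℚ b)))
  regroup = solve-∀ ℚ-ring
  cancel : ∀ y a → y +ℚ (a -ℚ a) ≡ y
  cancel = solve-∀ ℚ-ring

quotient-rowSum : ∀ (G : Graph N) k (q : Fin N → Fin n) c → IsRegular G k → IsEquitable G q c →
                  ∀ l → ∑ (λ s → ℕ→ℚ (c l s)) ≡ ℕ→ℚ k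
quotient-rowSum G k q c regular eqq l with proj₁ eqq l
... | v , refl = begin
  ∑ (λ s → ℕ→ℚ (c (q v) s))           ≡⟨ ∑-cong (λ s → sym (*-identityʳ (ℕ→ℚ (c (q v) s)))) ⟩
  (toℚMat c · (λ _ → 1ℚ)) (q v)       ≡⟨ sym (·-lift G q c eqq (λ _ → 1ℚ) v) ⟩
  (adjMatrix G · (λ _ → 1ℚ)) v        ≡⟨ ∑-cong (λ u → *-identityʳ (adjMatrix G v u)) ⟩
  ∑ (λ u → 𝟙 (adj G v u))             ≡⟨ sym (count≡∑𝟙 (adj G v)) ⟩
  ℕ→ℚ (degree G v)                    ≡⟨ cong ℕ→ℚ (regular v) ⟩
  ℕ→ℚ k                               ∎
  where open ≡-Reasoning

quotient-diagonal<degree : ∀ (G : Graph N) k (q : Fin N → Fin n) c j → IsRegular G k → IsEquitable G q c →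
  (∃ λ u → ∃ λ v → adj G u v ≡ true × cell q j u ≡ true × cell q j v ≡ false) → c j j < k
quotient-diagonal<degree G k q c j regular eqq (u , v , uv , u∈Wj , v∉Wj) = begin-strict
  c j j                    ≡⟨ cong (λ s → c s j) (sym (cell-member q j u u∈Wj)) ⟩
  c (q u) j                ≡⟨ sym (proj₂ eqq u j) ⟩
  nbrsIn G u (cell q j)    <⟨ count-∧-< (adj G u) (cell q j) v uv v∉Wj ⟩
  degree G u               ≡⟨ regular u ⟩
  k                        ∎
  where open ℕ.≤-Reasoning

rij*[k+cij-cjj]≡cij : ∀ k (c : Fin n → Fin n → ℕ) i j → c j j < k →
                      rij k c i j *ℚ (ℕ→ℚ k +ℚ (ℕ→ℚ (c i j) -ℚ ℕ→ℚ (c j j))) ≡ ℕ→ℚ (c i j)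
rij*[k+cij-cjj]≡cij k c i j cjj<k = begin
  rij k c i j *ℚ (K +ℚ (cij -ℚ cjj))  ≡⟨ cong (rij k c i j *ℚ_) (sym denominator) ⟩
  (cij /ℕ D) *ℚ ℕ→ℚ D                ≡⟨ /ℕ-*-cancel cij D ⟩
  cij                                ∎
  where
  open ≡-Reasoning
  K = ℕ→ℚ k
  cij = ℕ→ℚ (c i j)
  cjj = ℕ→ℚ (c j j)
  D = k + c i j ∸ c j j
  cjj<k+cij : c j j < k + c i j
  cjj<k+cij = ℕ.<-≤-trans cjj<k (ℕ.m≤m+n k (c i j))
  instance
    D≢0 : NonZero D
    D≢0 = >-nonZero (ℕ.m<n⇒0<n∸m cjj<k+cij)
  denominator : ℕ→ℚ D ≡ K +ℚ (cij -ℚ cjj)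
  denominator = begin
    ℕ→ℚ (k + c i j ∸ c j j)     ≡⟨ ℕ→ℚ-∸ (ℕ.<⇒≤ cjj<k+cij) ⟩
    ℕ→ℚ (k + c i j) -ℚ cjj      ≡⟨ cong (_-ℚ cjj) (ℕ→ℚ-homo-+ k (c i j)) ⟩
    (K +ℚ cij) -ℚ cjj           ≡⟨ +-assoc K cij (-ℚ cjj) ⟩
    K +ℚ (cij -ℚ cjj)           ∎

hvec≡average : ∀ (G : Graph N) k {p : Fin N → Fin m} (q : Fin N → Fin n) c i j → IsPartition p →
  ∀ d t → hvec G k p q c i j d t ≡ average p (λ u → (δ (q u) j -ℚ rij k c i j) -ℚ d (q u)) t
hvec≡average G k {p} q c i j part d t = begin
  (0ℚ -ℚ r) -ℚ ∑ (λ l → (ℕ→ℚ (count (λ v → cell p t v ∧ cell q l v)) /ℕ cellSize p t) *ℚ z l)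
    ≡⟨ cong (λ a → (0ℚ -ℚ r) -ℚ a) (average-lift p q z t) ⟩
  (0ℚ -ℚ r) -ℚ average p (z ∘ q) t
    ≡⟨ negate r (average p (z ∘ q) t) ⟩
  -ℚ 1ℚ *ℚ average p (z ∘ q) t +ℚ -ℚ r
    ≡⟨ cong (_+ℚ -ℚ r) (sym (average-* p (-ℚ 1ℚ) (z ∘ q) t)) ⟩
  average p (λ u → -ℚ 1ℚ *ℚ z (q u)) t +ℚ -ℚ r
    ≡⟨ sym (average-+-const p (λ u → -ℚ 1ℚ *ℚ z (q u)) (-ℚ r) t) ⟩
  average p (λ u → -ℚ 1ℚ *ℚ z (q u) +ℚ -ℚ r) t
    ≡⟨ average-cong p (λ u → rearrange (d (q u)) (δ (q u) j) r) t ⟩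
  average p (λ u → (δ (q u) j -ℚ r) -ℚ d (q u)) t
    ∎
  where
  open ≡-Reasoning
  instance
    cellSize-t≢0 : NonZero (cellSize p t)
    cellSize-t≢0 = cellSize-nonZero p part t
  r = rij k c i j
  z : Fin _ → ℚ
  z l = d l -ℚ δ l j
  negate : ∀ r a → (0ℚ -ℚ r) -ℚ a ≡ -ℚ 1ℚ *ℚ a +ℚ -ℚ r
  negate = solve-∀ ℚ-ring
  rearrange : ∀ d δ r → -ℚ 1ℚ *ℚ (d -ℚ δ) +ℚ -ℚ r ≡ (δ -ℚ r) -ℚ d
  rearrange = solve-∀ ℚ-ring

hvec-eigen : ∀ (G : Graph N) k (p : Fin N → Fin m) b → IsEquitable G p b →
  ∀ (q : Fin N → Fin n) c → IsEquitable G q c → ∀ i j →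
  IsSolution c i j (λ l → δ l j -ℚ rij k c i j) → ∀ d → IsSolution c i j d →
  let h = hvec G k p q c i j d in
  ∀ t → (toℚMat b · h) t ≡ (ℕ→ℚ (c j j) -ℚ ℕ→ℚ (c i j)) *ℚ h t
hvec-eigen G k p b eqp q c eqq i j d₀-solves d d-solves t = begin
  (toℚMat b · h) t                  ≡⟨ ∑-cong (λ s → cong (ℕ→ℚ (b t s) *ℚ_) (h≡average s)) ⟩
  (toℚMat b · average p W) t        ≡⟨ average-eigen G p b eqp {λ₀ = λ₀} AW≡λW t ⟩
  λ₀ *ℚ average p W t               ≡⟨ cong (λ₀ *ℚ_) (sym (h≡average t)) ⟩
  λ₀ *ℚ h t                         ∎
  where
  open ≡-Reasoning
  h = hvec G k p q c i j d
  λ₀ = ℕ→ℚ (c j j) -ℚ ℕ→ℚ (c i j)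
  w : Fin _ → ℚ
  w l = (δ l j -ℚ rij k c i j) -ℚ d l
  W : Fin _ → ℚ
  W = w ∘ q
  h≡average : ∀ t → h t ≡ average p W t
  h≡average = hvec≡average G k q c i j (proj₁ eqp) d
  AW≡λW : ∀ v → (adjMatrix G · W) v ≡ λ₀ *ℚ W v
  AW≡λW v = trans (·-lift G q c eqq w v)
    (difference-of-solutions-eigen (toℚMat c) (ℕ→ℚ (c i j)) (ℕ→ℚ (c j j)) _ d₀-solves d-solves (q v))

theorem2p3 : ∀ {N m n : ℕ} (G : Graph N) (k : ℕ) → 1 ≤ k → IsRegular G k
    → (p : Fin N → Fin m) (b : Fin m → Fin m → ℕ) → IsEquitable G p b
    → (q : Fin N → Fin n) (c : Fin n → Fin n → ℕ) → IsEquitable G q c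
    → (i j : Fin n) → i ≢ j
    → (∃ λ u → ∃ λ v → adj G u v ≡ true × cell q j u ≡ true × cell q j v ≡ false)
    → (∃ λ d → IsSolution c i j d)
      × (∀ d → IsSolution c i j d →
           let h = hvec G k p q c i j d
               μ = ℕ→ℚ (c i j) -ℚ ℕ→ℚ (c j j)
           in (∀ t → (toℚMat b · h) t +ℚ μ *ℚ h t ≡ 0ℚ)
              × (IsZeroVec h
                 ⊎ (IsEigenvector (toℚMat b) (ℕ→ℚ (c j j) -ℚ ℕ→ℚ (c i j)) h
                    × IsEigenvalue (adjMatrix G) (ℕ→ℚ (c j j) -ℚ ℕ→ℚ (c i j)))))
theorem2p3 {n = n} G k _ regular p b eqp q c eqq i j _ leaves =
    (d₀ , d₀-solves)
  , λ d d-solves →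
      let Bh≡λh = hvec-eigen G k p b eqp q c eqq i j d₀-solves d d-solves in
      (λ t → eigen⇒shifted-kernel (ℕ→ℚ (c i j)) (ℕ→ℚ (c j j)) (hvec G k p q c i j d t) (Bh≡λh t))
    , zero-or-eigen G p b eqp {λ₀ = ℕ→ℚ (c j j) -ℚ ℕ→ℚ (c i j)} Bh≡λh
  where
  d₀ : Fin n → ℚ
  d₀ l = δ l j -ℚ rij k c i j
  d₀-solves : IsSolution c i j d₀
  d₀-solves = δ-minus-const-solves c i j (quotient-rowSum G k q c regular eqq)
                (rij*[k+cij-cjj]≡cij k c i j (quotient-diagonal<degree G k q c j regular eqq leaves))
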